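{- Let $G$ be a finite, simple, connected graph with minimum degree $\geq2$ which is not a cycle graph. Let $t\geq3$ be an integer not larger than the length of a shortest cycle of $G$, and let $\tau=\lfloor t/2\rfloor$. Then $\chi_t(G)=\tau+1$ if and only if $G$ is circularly $t$-partite.
   Context: All graphs are finite, simple and connected. A path of length $t$ is a sequence $v_1,\ldots,v_{t+1}$ of distinct vertices with $v_j\sim v_{j+1}$; its endpoints are $v_1$ and $v_{t+1}$. A cycle of length $\ell\ge 3$ is a sequence of $\ell$ distinct vertices $v_1,\dots,v_\ell$ with $v_j\sim v_{j+1}$ and $v_\ell\sim v_1$. A (not necessarily proper) colouring of the vertices is $t$-periodic if every path of length $t$ has endpoints of the same colour; $\chi_t(G)$ is the largest $k$ such that $G$ has a $t$-periodic colouring of the vertices using exactly $k$ colours. An oriented edge $[v,w]$ is an edge $\{v,w\}$ with input $v$ and output $w$; $\mathcal{O}=\{[v,w],[w,v]: v\sim w\}$. For $k\geq 1$, $G$ is circularly $k$-partite if $\mathcal{O}$ can be partitioned as $\mathcal{O}=\mathcal{O}_1\sqcup\cdots\sqcup\mathcal{O}_k$ with all $\mathcal{O}_j$ non-empty and such that $[v,w]\in\mathcal{O}_j$ implies $[w,z]\in\mathcal{O}_{j+1}$ for every $z\sim w$ with $z\neq v$, indices modulo $k$. -}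

module Defs where

open import Data.Nat using (ℕ; zero; suc; _≤_; _<_)
open import Data.Nat.DivMod using (_%_; m%n<n)
open import Data.Fin using (Fin; toℕ; fromℕ<)
open import Data.Bool using (Bool; true; false)
open import Data.Product using (Σ; ∃; ∃-syntax; _×_; _,_)
open import Data.Sum using (_⊎_)
open import Relation.Binary.PropositionalEquality using (_≡_; _≢_)
open import Relation.Nullary using (¬_)
open import Function.Definitions using (Injective; Surjective)

sucMod : ∀ {k} → Fin k → Fin k
sucMod {suc k} i = fromℕ< (m%n<n (suc (toℕ i)) (suc k))

record Graph : Set where
  field
    n     : ℕ
    adj   : Fin n → Fin n → Bool
    sym   : ∀ u v → adj u v ≡ adj v u
    irrefl : ∀ v → adj v v ≡ false

module _ (G : Graph) where
  open Graph G

  _∼_ : Fin n → Fin n → Set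
  u ∼ v = adj u v ≡ true

  data Reach : Fin n → Fin n → Set where
    here : ∀ {v} → Reach v v
    step : ∀ {u v w} → u ∼ v → Reach v w → Reach u w

  Connected : Set
  Connected = ∀ u v → Reach u v

  MinDeg≥2 : Set
  MinDeg≥2 = ∀ v → Σ (Fin n) λ u → Σ (Fin n) λ w → u ≢ w × v ∼ u × v ∼ w

  record Path (t : ℕ) : Set where
    field
      vtx  : Fin (suc t) → Fin n
      inj  : Injective _≡_ _≡_ vtx
      edge : ∀ (j : Fin t) → vtx (Data.Fin.inject₁ j) ∼ vtx (Data.Fin.suc j)

  record Cycle (ℓ : ℕ) : Set where
    field
      len≥3 : 3 ≤ ℓ
      vtx   : Fin ℓ → Fin n
      inj   : Injective _≡_ _≡_ vtx
      edge  : ∀ (j : Fin ℓ) → vtx j ∼ vtx (sucMod j)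

  -- G is a cycle graph (isomorphic to C_n): a cycle through all n vertices
  -- whose consecutive pairs are exactly the edges of G.
  IsCycleGraph : Set
  IsCycleGraph = Σ (Cycle n) λ c → ∀ i j →
    Cycle.vtx c i ∼ Cycle.vtx c j → (j ≡ sucMod i ⊎ i ≡ sucMod j)

  t≤Girth : ℕ → Set
  t≤Girth t = ∀ ℓ → Cycle ℓ → t ≤ ℓ

  PeriodicColouring : ℕ → ℕ → Set
  PeriodicColouring t k = Σ (Fin n → Fin k) λ c →
    Surjective _≡_ _≡_ c ×
    (∀ (p : Path t) → c (Path.vtx p Data.Fin.zero) ≡ c (Path.vtx p (Data.Fin.fromℕ t)))

  -- χ_t(G) = k : k is the largest number of colours of a t-periodic colouring
  χ≡ : ℕ → ℕ → Set
  χ≡ t k = PeriodicColouring t k × (∀ m → PeriodicColouring t m → m ≤ k)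

  CircularlyPartite : ℕ → Set
  CircularlyPartite k =
    1 ≤ k ×
    Σ ((v w : Fin n) → v ∼ w → Fin k) λ part →
      (∀ (j : Fin k) → ∃[ v ] ∃[ w ] Σ (v ∼ w) λ e → part v w e ≡ j) ×
      (∀ v w z (e : v ∼ w) (e' : w ∼ z) → z ≢ v → part w z e' ≡ sucMod (part v w e))

{-# OPTIONS --safe #-}
-- A t-periodic colouring is t-periodic along every non-backtracking walk: since t is at most the
-- girth, a segment of length t is either a path or a closed t-cycle. Unless G is a cycle it has a
-- vertex w₀ with three neighbours. Going back along one arm from w₀ and out along another shows
-- that the colours β₀, β₁, … met along a non-backtracking walk leaving w₀ do not depend on the
-- walk and satisfy β_j = β_(t−j). Every oriented edge starts a non-backtracking walk through w₀,
-- so every colour is some β_r with r ≤ ⌊t/2⌋, and χ_t ≤ ⌊t/2⌋ + 1. In case of equality the β_r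
-- with r ≤ ⌊t/2⌋ are distinct, so the position modulo t at which an oriented edge occurs on such a
-- walk is well defined, and it is a circular t-partition. Conversely, for a circular t-partition λ
-- the sum λ(v,w) + λ(w,v) is the same for all edges, so the two out-labels at any vertex add up to
-- a constant 2o, and v ↦ ∣λ(v,w) − o∣ modulo t is a t-periodic colouring with ⌊t/2⌋ + 1 colours.

module Submission where

open import Defs
open import Data.Nat using (ℕ; zero; suc; pred; _+_; _*_; _∸_; _≤_; _<_; z≤n; s≤s; s≤s⁻¹; _≤?_; _<?_)
open import Data.Nat using (NonZero; >-nonZero; >-nonZero⁻¹)
open import Data.Nat.Properties
open import Data.Nat.DivMod
open import Data.Fin as Fin using (Fin; toℕ; fromℕ<)
open import Data.Fin.Properties
  using (toℕ-fromℕ<; toℕ-fromℕ; toℕ-injective; toℕ<n; toℕ-inject₁; fromℕ<-cong; injective⇒≤; punchOut-injective; any?)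
open import Data.Sum as Sum using (_⊎_; inj₁; inj₂; [_,_]′)
open import Data.Empty using (⊥-elim)
open import Function.Base using (_∘_)
open import Function.Definitions using (Injective; Surjective)
open import Function.Bundles using (_⇔_; mk⇔)
open import Data.Nat.Tactic.RingSolver using (solve-∀)
open import Relation.Binary.Bundles using (Setoid)
open import Relation.Binary.Structures using (IsEquivalence)
open import Relation.Binary.PropositionalEquality
open import Relation.Nullary using (¬_; Dec; yes; no; does; contradiction)
open import Relation.Nullary.Decidable as Dec using (_×-dec_; ¬?)
import Relation.Binary.Reasoning.Setoid
open import Axiom.UniquenessOfIdentityProofs using (module Decidable⇒UIP)
open import Data.Bool using (Bool; true; false; _∨_)
import Data.Bool.Properties as Bool
open import Data.List using (allFin)
import Data.List.Relation.Unary.All as All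
open import Data.List.Membership.Propositional.Properties using (∈-allFin)
open import Data.List.Extrema.Nat using (argmax; f[xs]≤f[argmax])
open import Data.Product using (Σ; ∃; _×_; _,_; proj₁; proj₂)

toℕ-sucMod : ∀ {k} .{{_ : NonZero k}} (i : Fin k) → toℕ (sucMod i) ≡ suc (toℕ i) % k
toℕ-sucMod {suc k} i = toℕ-fromℕ< (m%n<n (suc (toℕ i)) (suc k))

injective⇒surjective : ∀ {N} (h : Fin N → Fin N) → Injective _≡_ _≡_ h → ∀ y → ∃ λ x → h x ≡ y
injective⇒surjective {suc N} h h-injective y with any? (λ x → h x Fin.≟ y)
... | yes found = found
... | no  ¬found = contradiction (injective⇒≤ avoid-injective) 1+n≰n
  where
    avoid : Fin (suc N) → Fin N
    avoid x = Fin.punchOut {i = y} {j = h x} (λ e → ¬found (x , sym e))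
    avoid-injective : Injective _≡_ _≡_ avoid
    avoid-injective {i} {j} e = h-injective (punchOut-injective (λ e → ¬found (i , sym e)) (λ e → ¬found (j , sym e)) e)

leastTrue : (ℕ → Bool) → ℕ → ℕ
leastTrue f zero    = zero
leastTrue f (suc m) with f zero
... | true  = zero
... | false = suc (leastTrue (f ∘ suc) m)

leastTrue-true : ∀ (f : ℕ → Bool) m → f m ≡ true → f (leastTrue f m) ≡ true
leastTrue-true f zero    fm = fm
leastTrue-true f (suc m) fm with f zero in f0
... | true  = f0
... | false = leastTrue-true (f ∘ suc) m fm

leastTrue-minimal : ∀ (f : ℕ → Bool) m {j} → f j ≡ true → leastTrue f m ≤ j
leastTrue-minimal f zero    _  = z≤n
leastTrue-minimal f (suc m) {j} fj with f zero in f0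
leastTrue-minimal f (suc m) {j}     fj | true  = z≤n
leastTrue-minimal f (suc m) {zero}  fj | false = contradiction (trans (sym f0) fj) λ ()
leastTrue-minimal f (suc m) {suc j} fj | false = s≤s (leastTrue-minimal (f ∘ suc) m fj)

module Modular (t : ℕ) .{{_ : NonZero t}} where

  infix 4 _≡ₘ_
  record _≡ₘ_ (p q : ℕ) : Set where
    constructor mk≡ₘ
    field %-≡ : p % t ≡ q % t

  ≡ₘ-isEquivalence : IsEquivalence _≡ₘ_
  ≡ₘ-isEquivalence = record
    { refl  = mk≡ₘ refl
    ; sym   = λ (mk≡ₘ e) → mk≡ₘ (sym e)
    ; trans = λ (mk≡ₘ e) (mk≡ₘ e′) → mk≡ₘ (trans e e′)
    }

  ≡ₘ-setoid : Setoid _ _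
  ≡ₘ-setoid = record { isEquivalence = ≡ₘ-isEquivalence }

  open IsEquivalence ≡ₘ-isEquivalence public
    using () renaming (refl to ≡ₘ-refl; sym to ≡ₘ-sym; trans to ≡ₘ-trans)

  module ≡ₘ-Reasoning = Relation.Binary.Reasoning.Setoid ≡ₘ-setoid

  0%t≡0 : 0 % t ≡ 0
  0%t≡0 = m*n%n≡0 0 t

  ≡⇒≡ₘ : ∀ {p q} → p ≡ q → p ≡ₘ q
  ≡⇒≡ₘ e = mk≡ₘ (cong (_% t) e)

  m%t≡ₘm : ∀ p → p % t ≡ₘ p
  m%t≡ₘm p = mk≡ₘ (m%n%n≡m%n p t)

  m+t≡ₘm : ∀ p → p + t ≡ₘ p
  m+t≡ₘm p = mk≡ₘ ([m+n]%n≡m%n p t)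

  +-congₘ : ∀ {p q r s} → p ≡ₘ q → r ≡ₘ s → p + r ≡ₘ q + s
  +-congₘ {p} {q} {r} {s} (mk≡ₘ e) (mk≡ₘ e′) = mk≡ₘ (begin
    (p + r) % t           ≡⟨ %-distribˡ-+ p r t ⟩
    (p % t + r % t) % t   ≡⟨ cong₂ (λ a b → (a + b) % t) e e′ ⟩
    (q % t + s % t) % t   ≡⟨ %-distribˡ-+ q s t ⟨
    (q + s) % t           ∎)
    where open ≡-Reasoning

  +-congˡₘ : ∀ p {q r} → q ≡ₘ r → p + q ≡ₘ p + r
  +-congˡₘ p = +-congₘ (≡ₘ-refl {p})

  +-congʳₘ : ∀ r {p q} → p ≡ₘ q → p + r ≡ₘ q + r
  +-congʳₘ r e = +-congₘ e (≡ₘ-refl {r})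

  +-cancelʳₘ : ∀ p q r → p + r ≡ₘ q + r → p ≡ₘ q
  +-cancelʳₘ p q r e = begin
    p                          ≈⟨ add-complement p ⟨
    p + r + (t ∸ r % t)        ≈⟨ +-congₘ e ≡ₘ-refl ⟩
    q + r + (t ∸ r % t)        ≈⟨ add-complement q ⟩
    q                          ∎
    where
      open ≡ₘ-Reasoning
      add-complement : ∀ a → a + r + (t ∸ r % t) ≡ₘ a
      add-complement a = begin
        a + r + (t ∸ r % t)          ≡⟨ +-assoc a r _ ⟩
        a + (r + (t ∸ r % t))        ≈⟨ +-congˡₘ a (+-congʳₘ (t ∸ r % t) (m%t≡ₘm r)) ⟨
        a + (r % t + (t ∸ r % t))    ≡⟨ cong (a +_) (m+[n∸m]≡n (<⇒≤ (m%n<n r t))) ⟩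
        a + t                        ≈⟨ m+t≡ₘm a ⟩
        a                            ∎

  ≡ₘ⇒≡ : ∀ {p q} → p < t → q < t → p ≡ₘ q → p ≡ q
  ≡ₘ⇒≡ {p} {q} p<t q<t (mk≡ₘ e) = begin
    p       ≡⟨ m<n⇒m%n≡m p<t ⟨
    p % t   ≡⟨ e ⟩
    q % t   ≡⟨ m<n⇒m%n≡m q<t ⟩
    q       ∎
    where open ≡-Reasoning

module AbsMod (t : ℕ) .{{_ : NonZero t}} where
  open Modular t

  τ : ℕ
  τ = t / 2

  t≡t%2+2τ : t ≡ t % 2 + (τ + τ)
  t≡t%2+2τ = trans (m≡m%n+[m/n]*n t 2) (cong (t % 2 +_) (trans (*-comm τ 2) (cong (τ +_) (+-identityʳ τ))))

  2τ≤t : τ + τ ≤ t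
  2τ≤t = subst (τ + τ ≤_) (sym t≡t%2+2τ) (m≤n+m (τ + τ) (t % 2))

  t≤1+2τ : t ≤ suc (τ + τ)
  t≤1+2τ = subst (_≤ suc (τ + τ)) (sym t≡t%2+2τ) (+-monoˡ-≤ (τ + τ) (s≤s⁻¹ (m%n<n t 2)))

  τ<t : τ < t
  τ<t = m/n<m t 2 (s≤s (s≤s z≤n))

  fold : ℕ → ℕ
  fold r with r ≤? τ
  ... | yes _ = r
  ... | no  _ = t ∸ r

  fold≤τ : ∀ r → fold r ≤ τ
  fold≤τ r with r ≤? τ
  ... | yes r≤τ = r≤τ
  ... | no  r≰τ = m≤n+o⇒m∸n≤o t r (≤-trans t≤1+2τ (+-monoˡ-≤ τ (≰⇒> r≰τ)))

  fold-small : ∀ {r} → r ≤ τ → fold r ≡ r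
  fold-small {r} r≤τ with r ≤? τ
  ... | yes _   = refl
  ... | no  r≰τ = contradiction r≤τ r≰τ

  fold-injective : ∀ {r s} → r < t → s < t → fold r ≡ fold s → r ≡ s ⊎ r + s ≡ t
  fold-injective {r} {s} r<t s<t e with r ≤? τ | s ≤? τ
  ... | yes _ | yes _ = inj₁ e
  ... | yes _ | no  _ = inj₂ (trans (cong (_+ s) e) (m∸n+n≡m (<⇒≤ s<t)))
  ... | no  _ | yes _ = inj₂ (trans (cong (r +_) (sym e)) (m+[n∸m]≡n (<⇒≤ r<t)))
  ... | no  _ | no  _ = inj₁ (∸-cancelˡ-≡ (<⇒≤ r<t) (<⇒≤ s<t) e)

  fold-complement : ∀ {r s} → r + s ≡ t → fold r ≡ fold s
  fold-complement {r} {s} e with r ≤? τ | s ≤? τ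
  ... | yes r≤τ | yes s≤τ = ≤-antisym (≤-trans r≤τ τ≤s) (≤-trans s≤τ τ≤r)
    where
      τ≤r : τ ≤ r
      τ≤r = +-cancelʳ-≤ τ τ r (≤-trans 2τ≤t (≤-trans (≤-reflexive (sym e)) (+-monoʳ-≤ r s≤τ)))
      τ≤s : τ ≤ s
      τ≤s = +-cancelˡ-≤ τ τ s (≤-trans 2τ≤t (≤-trans (≤-reflexive (sym e)) (+-monoˡ-≤ s r≤τ)))
  ... | yes _ | no  _ = sym (trans (cong (_∸ s) (sym e)) (m+n∸n≡m r s))
  ... | no  _ | yes _ = trans (cong (_∸ r) (sym e)) (m+n∸m≡n r s)
  ... | no  r≰τ | no  s≰τ = contradiction (≤-reflexive e) (<⇒≱ (begin-strict
    t                  ≤⟨ t≤1+2τ ⟩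
    suc (τ + τ)        <⟨ s≤s (≤-reflexive (sym (+-suc τ τ))) ⟩
    suc τ + suc τ      ≤⟨ +-mono-≤ (≰⇒> r≰τ) (≰⇒> s≰τ) ⟩
    r + s              ∎))
    where open ≤-Reasoning

  -- The distance from p to the nearest multiple of t: the absolute value on ℤ/t.
  ∣_∣ₘ : ℕ → ℕ
  ∣ p ∣ₘ = fold (p % t)

  ∣∣ₘ≤τ : ∀ p → ∣ p ∣ₘ ≤ τ
  ∣∣ₘ≤τ p = fold≤τ (p % t)

  ∣∣ₘ-small : ∀ {p} → p ≤ τ → ∣ p ∣ₘ ≡ p
  ∣∣ₘ-small {p} p≤τ = trans (cong fold (m<n⇒m%n≡m (≤-<-trans p≤τ τ<t))) (fold-small p≤τ)

  ∣∣ₘ-cong : ∀ {p q} → p ≡ₘ q → ∣ p ∣ₘ ≡ ∣ q ∣ₘ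
  ∣∣ₘ-cong (mk≡ₘ e) = cong fold e

  %≡0⇒≡0⊎≡t : ∀ {s} → s < t + t → s % t ≡ 0 → s ≡ 0 ⊎ s ≡ t
  %≡0⇒≡0⊎≡t {s} s<2t s%t≡0 with s <? t
  ... | yes s<t = inj₁ (trans (sym (m<n⇒m%n≡m s<t)) s%t≡0)
  ... | no  s≮t = inj₂ (≤-antisym (m∸n≡0⇒m≤n s∸t≡0) (≮⇒≥ s≮t))
    where
      s∸t<t : s ∸ t < t
      s∸t<t = subst (s ∸ t <_) (m+n∸n≡m t t) (∸-monoˡ-< s<2t (≮⇒≥ s≮t))
      s∸t≡0 : s ∸ t ≡ 0
      s∸t≡0 = begin
        s ∸ t             ≡⟨ m<n⇒m%n≡m s∸t<t ⟨
        (s ∸ t) % t       ≡⟨ [m+n]%n≡m%n (s ∸ t) t ⟨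
        (s ∸ t + t) % t   ≡⟨ cong (_% t) (m∸n+n≡m (≮⇒≥ s≮t)) ⟩
        s % t             ≡⟨ s%t≡0 ⟩
        0                 ∎
        where open ≡-Reasoning

  ∣∣ₘ-neg : ∀ p q → p + q ≡ₘ 0 → ∣ p ∣ₘ ≡ ∣ q ∣ₘ
  ∣∣ₘ-neg p q (mk≡ₘ e)
    with %≡0⇒≡0⊎≡t (+-mono-< (m%n<n p t) (m%n<n q t)) (trans (sym (%-distribˡ-+ p q t)) (trans e 0%t≡0))
  ... | inj₁ s≡0 = cong fold (trans (m+n≡0⇒m≡0 (p % t) s≡0) (sym (m+n≡0⇒n≡0 (p % t) s≡0)))
  ... | inj₂ s≡t = fold-complement {p % t} {q % t} s≡t

  ∣∣ₘ-injective : ∀ {p q} → ∣ p ∣ₘ ≡ ∣ q ∣ₘ → p ≡ₘ q ⊎ p + q ≡ₘ 0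
  ∣∣ₘ-injective {p} {q} e with fold-injective {p % t} {q % t} (m%n<n p t) (m%n<n q t) e
  ... | inj₁ e′ = inj₁ (mk≡ₘ e′)
  ... | inj₂ e′ = inj₂ (mk≡ₘ (trans (%-distribˡ-+ p q t) (trans (cong (_% t) e′) (trans (n%n≡0 t) (sym 0%t≡0)))))

  -- If p ≡ −q and p + 1 ≡ −(q + 1), then 2 ≡ 0, which fails for t ≥ 3.
  ∣∣ₘ-pair-injective : 3 ≤ t → ∀ {p q} → ∣ p ∣ₘ ≡ ∣ q ∣ₘ → ∣ suc p ∣ₘ ≡ ∣ suc q ∣ₘ → p ≡ₘ q
  ∣∣ₘ-pair-injective 3≤t {p} {q} e e′ with ∣∣ₘ-injective e | ∣∣ₘ-injective e′
  ... | inj₁ p≡q | _ = p≡q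
  ... | inj₂ _ | inj₁ p+1≡q+1 = +-cancelʳₘ p q 1 (begin
    p + 1     ≡⟨ +-comm p 1 ⟩
    suc p     ≈⟨ p+1≡q+1 ⟩
    suc q     ≡⟨ +-comm 1 q ⟩
    q + 1     ∎)
    where open ≡ₘ-Reasoning
  ... | inj₂ p+q≡0 | inj₂ p+q+2≡0 = contradiction (≡ₘ⇒≡ (<-≤-trans (s≤s (s≤s (s≤s z≤n))) 3≤t) (<-≤-trans (s≤s z≤n) 3≤t) 2≡0)
                                               λ ()
    where
      open ≡ₘ-Reasoning
      2≡0 : 2 ≡ₘ 0
      2≡0 = begin
        2               ≈⟨ +-congʳₘ 2 p+q≡0 ⟨
        p + q + 2       ≡⟨ trans (+-comm (p + q) 2) (cong suc (sym (+-suc p q))) ⟩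
        suc p + suc q   ≈⟨ p+q+2≡0 ⟩
        0               ∎

module Basics (G : Graph) where
  open Graph G using (n; adj)

  V : Set
  V = Fin n

  infix 4 _~_
  _~_ : V → V → Set
  _~_ = _∼_ G

  ~-sym : ∀ {u v} → u ~ v → v ~ u
  ~-sym {u} {v} e = trans (Graph.sym G v u) e

  ~-irrefl : ∀ {v} → ¬ v ~ v
  ~-irrefl {v} e with trans (sym (Graph.irrefl G v)) e
  ... | ()

  ~-irrelevant : ∀ {u v} (e e′ : u ~ v) → e ≡ e′
  ~-irrelevant = Decidable⇒UIP.≡-irrelevant Bool._≟_

  record Claw : Set where
    field
      centre a b c : V
      a≢b : a ≢ b
      a≢c : a ≢ c
      b≢c : b ≢ c
      centre~a : centre ~ a
      centre~b : centre ~ b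
      centre~c : centre ~ c

  claw? : Dec Claw
  claw? = Dec.map′ toClaw fromClaw
    (any? λ w → any? λ a → any? λ b → any? λ c →
      ¬? (a Fin.≟ b) ×-dec ¬? (a Fin.≟ c) ×-dec ¬? (b Fin.≟ c) ×-dec
      (adj w a Bool.≟ true) ×-dec (adj w b Bool.≟ true) ×-dec (adj w c Bool.≟ true))
    where
      ClawΣ : Set
      ClawΣ = ∃ λ w → ∃ λ a → ∃ λ b → ∃ λ c → a ≢ b × a ≢ c × b ≢ c × w ~ a × w ~ b × w ~ c
      toClaw : ClawΣ → Claw
      toClaw (w , a , b , c , a≢b , a≢c , b≢c , w~a , w~b , w~c) = record
        { centre = w ; a = a ; b = b ; c = c ; a≢b = a≢b ; a≢c = a≢c ; b≢c = b≢c
        ; centre~a = w~a ; centre~b = w~b ; centre~c = w~c }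
      fromClaw : Claw → ClawΣ
      fromClaw k = centre , a , b , c , a≢b , a≢c , b≢c , centre~a , centre~b , centre~c
        where open Claw k

module NonBacktracking (G : Graph) where
  open Basics G public
  open Graph G public using (n)

  record Walk : Set where
    field
      vtx             : ℕ → V
      edge            : ∀ k → vtx k ~ vtx (suc k)
      nonBacktracking : ∀ k → vtx k ≢ vtx (suc (suc k))
  open Walk public

  cons : (v : V) (w : Walk) → v ~ vtx w 0 → v ≢ vtx w 1 → Walk
  cons v w e v≢w₁ = record { vtx = vtx′ ; edge = edge′ ; nonBacktracking = nb′ }
    where
      vtx′ : ℕ → V
      vtx′ zero    = v
      vtx′ (suc k) = vtx w k
      edge′ : ∀ k → vtx′ k ~ vtx′ (suc k)
      edge′ zero    = e
      edge′ (suc k) = edge w k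
      nb′ : ∀ k → vtx′ k ≢ vtx′ (suc (suc k))
      nb′ zero    = v≢w₁
      nb′ (suc k) = nonBacktracking w k

  drop : ℕ → Walk → Walk
  drop L w = record
    { vtx             = λ k → vtx w (k + L)
    ; edge            = λ k → edge w (k + L)
    ; nonBacktracking = λ k → nonBacktracking w (k + L)
    }

  -- Walk Z backwards from time m to its start, then continue along y.
  module Splice (Z y : Walk) (start : vtx Z 0 ≡ vtx y 0) (diverge : vtx Z 1 ≢ vtx y 1) where

    splice-vtx : ℕ → ℕ → V
    splice-vtx zero    j       = vtx y j
    splice-vtx (suc m) zero    = vtx Z (suc m)
    splice-vtx (suc m) (suc j) = splice-vtx m j

    splice-backward : ∀ m j → j ≤ m → splice-vtx m j ≡ vtx Z (m ∸ j)
    splice-backward zero    zero    _         = sym start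
    splice-backward (suc m) zero    _         = refl
    splice-backward (suc m) (suc j) (s≤s j≤m) = splice-backward m j j≤m

    splice-forward : ∀ m j → splice-vtx m (j + m) ≡ vtx y j
    splice-forward zero    j = cong (vtx y) (+-identityʳ j)
    splice-forward (suc m) j rewrite +-suc j m = splice-forward m j

    splice-edge : ∀ m j → splice-vtx m j ~ splice-vtx m (suc j)
    splice-edge zero    j       = edge y j
    splice-edge (suc m) zero    = subst (vtx Z (suc m) ~_) (sym (splice-backward m 0 z≤n)) (~-sym (edge Z m))
    splice-edge (suc m) (suc j) = splice-edge m j

    splice-nb : ∀ m j → splice-vtx m j ≢ splice-vtx m (suc (suc j))
    splice-nb zero          j       = nonBacktracking y j
    splice-nb (suc zero)    zero    = diverge
    splice-nb (suc (suc m)) zero    e = nonBacktracking Z m (sym (trans e (splice-backward m 0 z≤n)))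
    splice-nb (suc m)       (suc j) = splice-nb m j

    splice : ℕ → Walk
    splice m = record { vtx = splice-vtx m ; edge = splice-edge m ; nonBacktracking = splice-nb m }

  Distinct : Walk → ℕ → Set
  Distinct w k = ∀ {i j} → i < k → j < k → vtx w i ≡ vtx w j → i ≡ j

  distinct-extend : ∀ {w k} → Distinct w k → (∀ {i} → i < k → vtx w i ≢ vtx w k) → Distinct w (suc k)
  distinct-extend {w} {k} dist new {i} {j} i<1+k j<1+k e with m≤n⇒m<n∨m≡n (s≤s⁻¹ i<1+k) | m≤n⇒m<n∨m≡n (s≤s⁻¹ j<1+k)
  ... | inj₁ i<k  | inj₁ j<k  = dist i<k j<k e
  ... | inj₁ i<k  | inj₂ refl = contradiction e (new i<k)
  ... | inj₂ refl | inj₁ j<k  = contradiction (sym e) (new j<k)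
  ... | inj₂ refl | inj₂ refl = refl

  record FirstRepeat (w : Walk) (b : ℕ) : Set where
    field
      start gap : ℕ
      gap>0     : 0 < gap
      end≤b     : start + gap ≤ b
      closes    : vtx w start ≡ vtx w (start + gap)
      distinct  : Distinct w (start + gap)

  distinct⊎firstRepeat : ∀ w b → Distinct w (suc b) ⊎ FirstRepeat w b
  distinct⊎firstRepeat w zero = inj₁ λ { (s≤s z≤n) (s≤s z≤n) _ → refl }
  distinct⊎firstRepeat w (suc b) with distinct⊎firstRepeat w b
  ... | inj₂ r = inj₂ record { FirstRepeat r hiding (end≤b) ; end≤b = m≤n⇒m≤1+n (FirstRepeat.end≤b r) }
  ... | inj₁ dist with any? (λ (i : Fin (suc b)) → vtx w (toℕ i) Fin.≟ vtx w (suc b))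
  ... | no ¬rep = inj₁ (distinct-extend {w} {suc b} dist λ {i} i<1+b e →
                    ¬rep (fromℕ< i<1+b , subst (λ k → vtx w k ≡ vtx w (suc b)) (sym (toℕ-fromℕ< i<1+b)) e))
  ... | yes (i , e) = inj₂ record
    { start = toℕ i ; gap = suc b ∸ toℕ i ; gap>0 = m<n⇒0<n∸m (toℕ<n i)
    ; end≤b = ≤-reflexive i+gap≡1+b
    ; closes = trans e (cong (vtx w) (sym i+gap≡1+b))
    ; distinct = subst (Distinct w) (sym i+gap≡1+b) dist }
    where
      i+gap≡1+b : toℕ i + (suc b ∸ toℕ i) ≡ suc b
      i+gap≡1+b = m+[n∸m]≡n (<⇒≤ (toℕ<n i))

  repeat-gap≥3 : ∀ w {a ℓ} → 0 < ℓ → vtx w a ≡ vtx w (a + ℓ) → 3 ≤ ℓ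
  repeat-gap≥3 w {a} {1} _ e = contradiction (subst (vtx w a ~_) (cong (vtx w) (sym (+-comm a 1))) (edge w a))
                                              (subst (λ v → ¬ vtx w a ~ v) e ~-irrefl)
  repeat-gap≥3 w {a} {2} _ e = contradiction (trans e (cong (vtx w) (+-comm a 2))) (nonBacktracking w a)
  repeat-gap≥3 w {ℓ = suc (suc (suc _))} _ _ = s≤s (s≤s (s≤s z≤n))

  cycleOfRepeat : ∀ w a ℓ → 3 ≤ ℓ → vtx w a ≡ vtx w (a + ℓ) → Distinct w (a + ℓ) → Cycle G ℓ
  cycleOfRepeat w a ℓ 3≤ℓ closes dist = record { len≥3 = 3≤ℓ ; vtx = vtx′ ; inj = inj′ ; edge = edge′ }
    where
      instance
        ℓ-nonZero : NonZero ℓ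
        ℓ-nonZero = >-nonZero (≤-trans (s≤s z≤n) 3≤ℓ)
      vtx′ : Fin ℓ → V
      vtx′ i = vtx w (a + toℕ i)
      inj′ : ∀ {i j} → vtx′ i ≡ vtx′ j → i ≡ j
      inj′ {i} {j} e = toℕ-injective (+-cancelˡ-≡ a _ _ (dist (+-monoʳ-< a (toℕ<n i)) (+-monoʳ-< a (toℕ<n j)) e))
      edge-to-succ : ∀ i → i < ℓ → vtx w (a + i) ~ vtx w (a + suc i % ℓ)
      edge-to-succ i i<ℓ with m≤n⇒m<n∨m≡n i<ℓ
      ... | inj₁ 1+i<ℓ = subst (λ k → vtx w (a + i) ~ vtx w k)
              (trans (sym (+-suc a i)) (cong (a +_) (sym (m<n⇒m%n≡m 1+i<ℓ)))) (edge w (a + i))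
      ... | inj₂ 1+i≡ℓ = subst (vtx w (a + i) ~_) wraps (edge w (a + i))
        where
          open ≡-Reasoning
          wraps : vtx w (suc (a + i)) ≡ vtx w (a + suc i % ℓ)
          wraps = begin
            vtx w (suc (a + i))    ≡⟨ cong (vtx w) (trans (sym (+-suc a i)) (cong (a +_) 1+i≡ℓ)) ⟩
            vtx w (a + ℓ)          ≡⟨ closes ⟨
            vtx w a                ≡⟨ cong (vtx w) (+-identityʳ a) ⟨
            vtx w (a + 0)          ≡⟨ cong (λ k → vtx w (a + k)) (n%n≡0 ℓ) ⟨
            vtx w (a + ℓ % ℓ)      ≡⟨ cong (λ k → vtx w (a + k % ℓ)) 1+i≡ℓ ⟨
            vtx w (a + suc i % ℓ)  ∎
      edge′ : ∀ j → vtx′ j ~ vtx′ (sucMod j)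
      edge′ j = subst (λ k → vtx′ j ~ vtx w (a + k)) (sym (toℕ-sucMod j)) (edge-to-succ (toℕ j) (toℕ<n j))

  pathOfDistinct : ∀ w t → Distinct w (suc t) → Path G t
  pathOfDistinct w t dist = record
    { vtx  = λ i → vtx w (toℕ i)
    ; inj  = λ {i} {j} e → toℕ-injective (dist (toℕ<n i) (toℕ<n j) e)
    ; edge = λ j → subst (λ k → vtx w k ~ vtx w (suc (toℕ j))) (sym (toℕ-inject₁ j)) (edge w (toℕ j))
    }

module Greedy (G : Graph) (minDeg : MinDeg≥2 G) where
  open NonBacktracking G

  next : V → V → V
  next p u with minDeg u
  ... | y₁ , y₂ , _ with y₁ Fin.≟ p
  ...   | yes _ = y₂
  ...   | no  _ = y₁

  next-adj : ∀ p u → u ~ next p u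
  next-adj p u with minDeg u
  ... | y₁ , y₂ , _ , u~y₁ , u~y₂ with y₁ Fin.≟ p
  ...   | yes _ = u~y₂
  ...   | no  _ = u~y₁

  next-≢ : ∀ p u → next p u ≢ p
  next-≢ p u with minDeg u
  ... | y₁ , y₂ , y₁≢y₂ , _ with y₁ Fin.≟ p
  ...   | yes y₁≡p = λ y₂≡p → y₁≢y₂ (trans y₁≡p (sym y₂≡p))
  ...   | no  y₁≢p = y₁≢p

  out-edge : ∀ v → v ~ proj₁ (minDeg v)
  out-edge v = proj₁ (proj₂ (proj₂ (proj₂ (minDeg v))))

  greedy-vtx : V → V → ℕ → V
  greedy-vtx p u zero    = p
  greedy-vtx p u (suc k) = greedy-vtx u (next p u) k

  greedy-edge : ∀ p u → p ~ u → ∀ k → greedy-vtx p u k ~ greedy-vtx p u (suc k)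
  greedy-edge p u p~u zero    = p~u
  greedy-edge p u p~u (suc k) = greedy-edge u (next p u) (next-adj p u) k

  greedy-nb : ∀ p u k → greedy-vtx p u k ≢ greedy-vtx p u (suc (suc k))
  greedy-nb p u zero    e = next-≢ p u (sym e)
  greedy-nb p u (suc k)   = greedy-nb u (next p u) k

  greedy : (p u : V) → p ~ u → Walk
  greedy p u p~u = record { vtx = greedy-vtx p u ; edge = greedy-edge p u p~u ; nonBacktracking = greedy-nb p u }

module Periodicity (G : Graph) (t : ℕ) (girth : t≤Girth G t) where
  open NonBacktracking G

  -- The first repetition closes a cycle of length at most t, so it spans the whole segment.
  firstRepeat-closes : ∀ w → FirstRepeat w t → vtx w 0 ≡ vtx w t
  firstRepeat-closes w r = trans (cong (vtx w) (sym start≡0)) (trans closes (cong (vtx w) end≡t))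
    where
      open FirstRepeat r
      t≤gap : t ≤ gap
      t≤gap = girth gap (cycleOfRepeat w start gap (repeat-gap≥3 w gap>0 closes) closes distinct)
      end≡t : start + gap ≡ t
      end≡t = ≤-antisym end≤b (≤-trans t≤gap (m≤n+m gap start))
      start≡0 : start ≡ 0
      start≡0 = n≤0⇒n≡0 (subst (start ≤_) (n∸n≡0 gap) (m+n≤o⇒m≤o∸n start (≤-trans end≤b t≤gap)))

  Periodic : {C : Set} → (V → C) → Set
  Periodic c = ∀ (P : Path G t) → c (Path.vtx P Fin.zero) ≡ c (Path.vtx P (Fin.fromℕ t))

  module Along {C : Set} (c : V → C) (periodic : Periodic c) where

    periodic-walk₀ : ∀ w → c (vtx w 0) ≡ c (vtx w t)
    periodic-walk₀ w with distinct⊎firstRepeat w t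
    ... | inj₂ r    = cong c (firstRepeat-closes w r)
    ... | inj₁ dist = subst (λ k → c (vtx w 0) ≡ c (vtx w k)) (toℕ-fromℕ t) (periodic (pathOfDistinct w t dist))

    periodic-walk : ∀ w j → c (vtx w j) ≡ c (vtx w (j + t))
    periodic-walk w j = subst (λ k → c (vtx w j) ≡ c (vtx w k)) (+-comm t j) (periodic-walk₀ (drop j w))

    periodic-walk* : ∀ w j q → c (vtx w j) ≡ c (vtx w (j + q * t))
    periodic-walk* w j zero    = cong (c ∘ vtx w) (sym (+-identityʳ j))
    periodic-walk* w j (suc q) = begin
      c (vtx w j)                      ≡⟨ periodic-walk* w j q ⟩
      c (vtx w (j + q * t))            ≡⟨ periodic-walk w (j + q * t) ⟩
      c (vtx w (j + q * t + t))        ≡⟨ cong (c ∘ vtx w) (trans (+-assoc j (q * t) t) (cong (j +_) (+-comm (q * t) t))) ⟩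
      c (vtx w (j + suc q * t))        ∎
      where open ≡-Reasoning

module Reaching (G : Graph) (connected : Connected G) (minDeg : MinDeg≥2 G) (w₀ : Fin (Graph.n G)) where
  open Graph G using (adj)
  open NonBacktracking G
  open Greedy G minDeg

  mutual
    within : ℕ → V → Bool
    within zero    u = does (u Fin.≟ w₀)
    within (suc k) u = within k u ∨ does (neighbour-within? k u)

    neighbour-within? : ∀ k u → Dec (∃ λ y → u ~ y × within k y ≡ true)
    neighbour-within? k u = any? λ y → (adj u y Bool.≟ true) ×-dec (within k y Bool.≟ true)

  within-zero : ∀ {u} → within 0 u ≡ true → u ≡ w₀
  within-zero {u} h with u Fin.≟ w₀
  ... | yes u≡w₀ = u≡w₀

  within-suc⁻ : ∀ k {u} → within (suc k) u ≡ true → within k u ≡ true ⊎ ∃ λ y → u ~ y × within k y ≡ true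
  within-suc⁻ k {u} h with within k u | neighbour-within? k u
  ... | true  | _         = inj₁ refl
  ... | false | yes found = inj₂ found

  within-step : ∀ k {u y} → u ~ y → within k y ≡ true → within (suc k) u ≡ true
  within-step k {u} {y} u~y hy with neighbour-within? k u
  ... | yes _    = Bool.∨-zeroʳ (within k u)
  ... | no  none = contradiction (y , u~y , hy) none

  within-reach : ∀ {u} → Reach G u w₀ → ∃ λ k → within k u ≡ true
  within-reach {u} here = 0 , Dec.dec-true (u Fin.≟ u) refl
  within-reach (step u~y reach) with within-reach reach
  ... | k , hy = suc k , within-step k u~y hy

  reached : ∀ u → ∃ λ k → within k u ≡ true
  reached u = within-reach (connected u w₀)

  dist : V → ℕ
  dist u = leastTrue (λ k → within k u) (proj₁ (reached u))

  within-dist : ∀ u → within (dist u) u ≡ true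
  within-dist u = leastTrue-true (λ k → within k u) (proj₁ (reached u)) (proj₂ (reached u))

  dist-minimal : ∀ k {u} → within k u ≡ true → dist u ≤ k
  dist-minimal k {u} = leastTrue-minimal (λ k → within k u) (proj₁ (reached u))

  maxDist : ℕ
  maxDist = dist (argmax dist w₀ (allFin n))

  dist≤maxDist : ∀ u → dist u ≤ maxDist
  dist≤maxDist u = All.lookup (f[xs]≤f[argmax] w₀ (allFin n)) (∈-allFin u)

  dist≡0⇒≡w₀ : ∀ {u} → dist u ≡ 0 → u ≡ w₀
  dist≡0⇒≡w₀ {u} d≡0 = within-zero (subst (λ k → within k u ≡ true) d≡0 (within-dist u))

  towards : ∀ u → u ≢ w₀ → ∃ λ y → u ~ y × dist y < dist u
  towards u u≢w₀ with dist u in d≡ | within-dist u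
  ... | zero  | _ = contradiction (dist≡0⇒≡w₀ d≡) u≢w₀
  ... | suc k | h with within-suc⁻ k h
  ...   | inj₁ hk              = contradiction (subst (_≤ k) d≡ (dist-minimal k hk)) 1+n≰n
  ...   | inj₂ (y , u~y , hy) = y , u~y , s≤s (dist-minimal k hy)

  record Visiting (p u : V) : Set where
    field
      walk   : Walk
      vtx₀   : vtx walk 0 ≡ p
      vtx₁   : vtx walk 1 ≡ u
      time   : ℕ
      visits : vtx walk time ≡ w₀

  visiting-here : ∀ {p u} → p ~ u → u ≡ w₀ → Visiting p u
  visiting-here {p} {u} p~u u≡w₀ = record { walk = greedy p u p~u ; vtx₀ = refl ; vtx₁ = refl ; time = 1 ; visits = u≡w₀ }

  visiting-cons : ∀ {p u y} → p ~ u → p ≢ y → Visiting u y → Visiting p u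
  visiting-cons {p} p~u p≢y v = record
    { walk   = cons p walk (subst (p ~_) (sym vtx₀) p~u) (λ e → p≢y (trans e vtx₁))
    ; vtx₀   = refl
    ; vtx₁   = vtx₀
    ; time   = suc time
    ; visits = visits
    }
    where open Visiting v

  descent : ∀ k {u y} → u ~ y → dist y < dist u → dist y ≤ k → Visiting u y
  descent zero    u~y _ y≤0 = visiting-here u~y (dist≡0⇒≡w₀ (n≤0⇒n≡0 y≤0))
  descent (suc k) {u} {y} u~y y<u y≤1+k with y Fin.≟ w₀
  ... | yes y≡w₀ = visiting-here u~y y≡w₀
  ... | no  y≢w₀ with towards y y≢w₀
  ...   | y′ , y~y′ , y′<y = visiting-cons u~y u≢y′ (descent k y~y′ y′<y (s≤s⁻¹ (<-≤-trans y′<y y≤1+k)))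
    where
      u≢y′ : u ≢ y′
      u≢y′ refl = <-asym y<u y′<y

  visiting⊎descends : ∀ {p u} → p ~ u → Visiting p u ⊎ dist p < dist u
  visiting⊎descends {p} {u} p~u with u Fin.≟ w₀
  ... | yes u≡w₀ = inj₁ (visiting-here p~u u≡w₀)
  ... | no  u≢w₀ with towards u u≢w₀
  ...   | y , u~y , y<u with p Fin.≟ y
  ...     | yes refl = inj₂ y<u
  ...     | no  p≢y  = inj₁ (visiting-cons p~u p≢y (descent (dist y) u~y y<u ≤-refl))

  -- If the descent from u starts back at p, leave u through another neighbour z instead;
  -- should the descent from z return to u, then z is farther from w₀ than u and we recurse.
  visiting-bounded : ∀ f {p u} → p ~ u → maxDist ∸ dist u < f → Visiting p u
  visiting-bounded (suc f) {p} {u} p~u bound with visiting⊎descends p~u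
  ... | inj₁ v = v
  ... | inj₂ _ with visiting⊎descends (next-adj p u)
  ...   | inj₁ v   = visiting-cons p~u (next-≢ p u ∘ sym) v
  ...   | inj₂ u<z = visiting-cons p~u (next-≢ p u ∘ sym)
            (visiting-bounded f (next-adj p u) (<-≤-trans (∸-monoʳ-< u<z (dist≤maxDist (next p u))) (s≤s⁻¹ bound)))

  opaque
    visiting : ∀ {p u} → p ~ u → Visiting p u
    visiting {u = u} p~u = visiting-bounded (suc (maxDist ∸ dist u)) p~u ≤-refl

module ClawFree (G : Graph) (connected : Connected G) (minDeg : MinDeg≥2 G) (clawFree : ¬ Basics.Claw G) where
  open NonBacktracking G
  open Greedy G minDeg

  neighbours≤2 : ∀ {v p q z} → v ~ p → v ~ q → p ≢ q → v ~ z → z ≡ p ⊎ z ≡ q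
  neighbours≤2 {v} {p} {q} {z} v~p v~q p≢q v~z with z Fin.≟ p | z Fin.≟ q
  ... | yes z≡p | _       = inj₁ z≡p
  ... | no  _   | yes z≡q = inj₂ z≡q
  ... | no  z≢p | no  z≢q = contradiction claw clawFree
    where
      claw : Claw
      claw = record
        { centre = v ; a = p ; b = q ; c = z ; a≢b = p≢q ; a≢c = z≢p ∘ sym ; b≢c = z≢q ∘ sym
        ; centre~a = v~p ; centre~b = v~q ; centre~c = v~z }

  -- The first repeated vertex x_a of a walk would have three neighbours x_(a-1), x_(a+1), x_(a+ℓ-1).
  repeat-start≡0 : ∀ w a {ℓ} → 3 ≤ ℓ → vtx w a ≡ vtx w (a + ℓ) → Distinct w (a + ℓ) → a ≡ 0
  repeat-start≡0 w zero _ _ _ = refl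
  repeat-start≡0 w (suc a) {suc ℓ′} (s≤s 2≤ℓ′) closes distinct =
    ⊥-elim ([ back≢prev , back≢next ]′ (neighbours≤2 (~-sym (edge w a)) (edge w A) (nonBacktracking w a) back-edge))
    where
      A : ℕ
      A = suc a
      back-edge : vtx w A ~ vtx w (A + ℓ′)
      back-edge = ~-sym (subst (vtx w (A + ℓ′) ~_) (trans (cong (vtx w) (sym (+-suc A ℓ′))) (sym closes)) (edge w (A + ℓ′)))
      back<end : A + ℓ′ < A + suc ℓ′
      back<end = +-monoʳ-< A ≤-refl
      back≢prev : vtx w (A + ℓ′) ≢ vtx w a
      back≢prev e = >⇒≢ (<-≤-trans (n<1+n a) (m≤m+n A ℓ′))
                      (distinct back<end (<-≤-trans (n<1+n a) (m≤m+n A (suc ℓ′))) e)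
      back≢next : vtx w (A + ℓ′) ≢ vtx w (suc A)
      back≢next e = >⇒≢ 2≤ℓ′ (+-cancelˡ-≡ A ℓ′ 1 (trans (distinct back<end next<end e) (sym (+-comm A 1))))
        where
          next<end : suc A < A + suc ℓ′
          next<end = subst (_< A + suc ℓ′) (+-comm A 1) (+-monoʳ-< A (m≤n⇒m≤1+n 2≤ℓ′))

  module Closed (w : Walk) (ℓ : ℕ) .{{_ : NonZero ℓ}} (3≤ℓ : 3 ≤ ℓ)
                (closes : vtx w 0 ≡ vtx w ℓ) (distinct : Distinct w ℓ) where

    1<ℓ : 1 < ℓ
    1<ℓ = ≤-trans (s≤s (s≤s z≤n)) 3≤ℓ

    pred<ℓ : pred ℓ < ℓ
    pred<ℓ = subst (pred ℓ <_) (suc-pred ℓ) ≤-refl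

    cycle-neighbour : ∀ {m v} → m < ℓ → vtx w m ~ v → ∃ λ m′ → m′ < ℓ × vtx w m′ ≡ v × (m′ ≡ suc m % ℓ ⊎ m ≡ suc m′ % ℓ)
    cycle-neighbour {zero} {v} _ x₀~v with neighbours≤2 (edge w 0) x₀~last x₁≢last x₀~v
      where
        x₀~last : vtx w 0 ~ vtx w (pred ℓ)
        x₀~last = ~-sym (subst (vtx w (pred ℓ) ~_) (trans (cong (vtx w) (suc-pred ℓ)) (sym closes)) (edge w (pred ℓ)))
        x₁≢last : vtx w 1 ≢ vtx w (pred ℓ)
        x₁≢last e = contradiction (subst (3 ≤_) (trans (sym (suc-pred ℓ)) (cong suc (sym (distinct 1<ℓ pred<ℓ e)))) 3≤ℓ)
                      λ { (s≤s (s≤s ())) }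
    ... | inj₁ v≡x₁   = 1 , 1<ℓ , sym v≡x₁ , inj₁ (sym (m<n⇒m%n≡m 1<ℓ))
    ... | inj₂ v≡last = pred ℓ , pred<ℓ , sym v≡last , inj₂ (sym (trans (cong (_% ℓ) (suc-pred ℓ)) (n%n≡0 ℓ)))
    cycle-neighbour {suc k} {v} 1+k<ℓ x~v with neighbours≤2 (~-sym (edge w k)) (edge w (suc k)) (nonBacktracking w k) x~v
    ... | inj₁ v≡xₖ = k , <-trans (n<1+n k) 1+k<ℓ , sym v≡xₖ , inj₂ (sym (m<n⇒m%n≡m 1+k<ℓ))
    ... | inj₂ v≡xₖ₊₂ with m≤n⇒m<n∨m≡n 1+k<ℓ
    ...   | inj₁ 2+k<ℓ = suc (suc k) , 2+k<ℓ , sym v≡xₖ₊₂ , inj₁ (sym (m<n⇒m%n≡m 2+k<ℓ))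
    ...   | inj₂ 2+k≡ℓ = 0 , >-nonZero⁻¹ ℓ , trans closes (trans (cong (vtx w) (sym 2+k≡ℓ)) (sym v≡xₖ₊₂)) ,
                         inj₁ (sym (trans (cong (_% ℓ) 2+k≡ℓ) (n%n≡0 ℓ)))

    OnCycle : V → Set
    OnCycle v = ∃ λ m → m < ℓ × vtx w m ≡ v

    onCycle : ∀ v → OnCycle v
    onCycle v = go (connected v (vtx w 0))
      where
        go : ∀ {v} → Reach G v (vtx w 0) → OnCycle v
        go here = 0 , >-nonZero⁻¹ ℓ , refl
        go (step v~y reach) with go reach
        ... | m , m<ℓ , refl with cycle-neighbour m<ℓ (~-sym v~y)
        ...   | m′ , m′<ℓ , e , _ = m′ , m′<ℓ , e

    cycle : Cycle G ℓ
    cycle = cycleOfRepeat w 0 ℓ 3≤ℓ closes distinct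

    ℓ≡n : ℓ ≡ n
    ℓ≡n = ≤-antisym (injective⇒≤ (Cycle.inj cycle)) (injective⇒≤ index-injective)
      where
        index : V → Fin ℓ
        index v = fromℕ< (proj₁ (proj₂ (onCycle v)))
        index-injective : ∀ {u v} → index u ≡ index v → u ≡ v
        index-injective {u} {v} e = begin
          u                                  ≡⟨ proj₂ (proj₂ (onCycle u)) ⟨
          vtx w (proj₁ (onCycle u))          ≡⟨ cong (vtx w) (toℕ-fromℕ< _) ⟨
          vtx w (toℕ (index u))              ≡⟨ cong (vtx w ∘ toℕ) e ⟩
          vtx w (toℕ (index v))              ≡⟨ cong (vtx w) (toℕ-fromℕ< _) ⟩
          vtx w (proj₁ (onCycle v))          ≡⟨ proj₂ (proj₂ (onCycle v)) ⟩
          v                                  ∎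
          where open ≡-Reasoning

    cycle-consecutive : ∀ i j → Cycle.vtx cycle i ~ Cycle.vtx cycle j → j ≡ sucMod i ⊎ i ≡ sucMod j
    cycle-consecutive i j e with cycle-neighbour (toℕ<n i) e
    ... | m′ , m′<ℓ , x≡ , rel with distinct m′<ℓ (toℕ<n j) x≡
    ...   | refl = Sum.map (λ r → toℕ-injective (trans r (sym (toℕ-sucMod i))))
                                (λ r → toℕ-injective (trans r (sym (toℕ-sucMod j)))) rel

    isCycleGraph : IsCycleGraph G
    isCycleGraph = subst (λ k → Σ (Cycle G k) λ c → ∀ i j → Cycle.vtx c i ~ Cycle.vtx c j → j ≡ sucMod i ⊎ i ≡ sucMod j)
                         ℓ≡n (cycle , cycle-consecutive)

  clawFree⇒cycleGraph : V → IsCycleGraph G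
  clawFree⇒cycleGraph v = Closed.isCycleGraph X gap {{>-nonZero gap>0}} 3≤gap
                            (subst (λ a → vtx X a ≡ vtx X (a + gap)) start≡0 closes)
                            (subst (λ a → Distinct X (a + gap)) start≡0 distinct)
    where
      X : Walk
      X = greedy v (proj₁ (minDeg v)) (out-edge v)
      repeat : FirstRepeat X n
      repeat with distinct⊎firstRepeat X n
      ... | inj₂ r    = r
      ... | inj₁ dist = contradiction (injective⇒≤ {f = vtx X ∘ toℕ} λ e → toℕ-injective (dist (toℕ<n _) (toℕ<n _) e))
                                      1+n≰n
      open FirstRepeat repeat
      3≤gap : 3 ≤ gap
      3≤gap = repeat-gap≥3 X {start} gap>0 closes
      start≡0 : start ≡ 0
      start≡0 = repeat-start≡0 X start 3≤gap closes distinct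

module WithClaw (G : Graph) (connected : Connected G) (minDeg : MinDeg≥2 G)
            (t₁ : ℕ) (3≤t : 3 ≤ suc t₁) (girth : t≤Girth G (suc t₁)) (claw : Basics.Claw G) where
  open NonBacktracking G
  open Greedy G minDeg
  open Claw claw renaming (centre to w₀; c to c′; centre~c to centre~c′; a≢c to a≢c′; b≢c to b≢c′)

  t : ℕ
  t = suc t₁

  open Modular t
  open AbsMod t
  open Periodicity G t girth
  open Reaching G connected minDeg w₀

  A B C : Walk
  A = greedy w₀ a centre~a
  B = greedy w₀ b centre~b
  C = greedy w₀ c′ centre~c′

  module Colouring {Col : Set} (colour : V → Col) (periodic : Periodic colour) where
    open Along colour periodic

    reflect : ∀ (Z y : Walk) → vtx Z 0 ≡ vtx y 0 → vtx Z 1 ≢ vtx y 1 →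
              ∀ j → j ≤ t → colour (vtx Z (t ∸ j)) ≡ colour (vtx y j)
    reflect Z y start diverge j j≤t = begin
      colour (vtx Z (t ∸ j))          ≡⟨ cong colour (splice-backward t j j≤t) ⟨
      colour (splice-vtx t j)         ≡⟨ periodic-walk (splice t) j ⟩
      colour (splice-vtx t (j + t))   ≡⟨ cong colour (splice-forward t j) ⟩
      colour (vtx y j)                ∎
      where
        open Splice Z y start diverge
        open ≡-Reasoning

    arm : ℕ → Col
    arm j = colour (vtx B j)

    arm-reflect : ∀ j → j ≤ t → arm j ≡ arm (t ∸ j)
    arm-reflect j j≤t = begin
      arm j                           ≡⟨ reflect C B refl (b≢c′ ∘ sym) j j≤t ⟨
      colour (vtx C (t ∸ j))          ≡⟨ reflect A C refl a≢c′ (t ∸ j) (m∸n≤m t j) ⟨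
      colour (vtx A (t ∸ (t ∸ j)))    ≡⟨ cong (colour ∘ vtx A) (m∸[m∸n]≡n j≤t) ⟩
      colour (vtx A j)                ≡⟨ reflect B A refl (a≢b ∘ sym) j j≤t ⟨
      arm (t ∸ j)                     ∎
      where open ≡-Reasoning

    arm-from-centre : ∀ y → vtx y 0 ≡ w₀ → ∀ j → j ≤ t → colour (vtx y j) ≡ arm j
    arm-from-centre y y₀ j j≤t with vtx y 1 Fin.≟ b
    ... | no  y₁≢b = begin
      colour (vtx y j)                ≡⟨ reflect B y (sym y₀) (y₁≢b ∘ sym) j j≤t ⟨
      arm (t ∸ j)                     ≡⟨ arm-reflect j j≤t ⟨
      arm j                           ∎
      where open ≡-Reasoning
    ... | yes y₁≡b = begin
      colour (vtx y j)                ≡⟨ reflect A y (sym y₀) (λ e → a≢b (trans e y₁≡b)) j j≤t ⟨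
      colour (vtx A (t ∸ j))          ≡⟨ reflect B A refl (a≢b ∘ sym) (t ∸ j) (m∸n≤m t j) ⟨
      arm (t ∸ (t ∸ j))               ≡⟨ cong arm (m∸[m∸n]≡n j≤t) ⟩
      arm j                           ∎
      where open ≡-Reasoning

    colourAt : ℕ → Col
    colourAt p = arm (p % t)

    colourAt-from-centre : ∀ y → vtx y 0 ≡ w₀ → ∀ j → colour (vtx y j) ≡ colourAt j
    colourAt-from-centre y y₀ j = begin
      colour (vtx y j)                          ≡⟨ cong (colour ∘ vtx y) (m≡m%n+[m/n]*n j t) ⟩
      colour (vtx y (j % t + (j / t) * t))      ≡⟨ periodic-walk* y (j % t) (j / t) ⟨
      colour (vtx y (j % t))                    ≡⟨ arm-from-centre y y₀ (j % t) (<⇒≤ (m%n<n j t)) ⟩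
      colourAt j                                ∎
      where open ≡-Reasoning

    visit-phase : ∀ {p u} → Visiting p u → ℕ
    visit-phase vis = Visiting.time vis * t₁

    -- j + L t = (j + L (t − 1)) + L, and the walk is at the centre at time L.
    colourAt-visiting : ∀ {p u} (vis : Visiting p u) j → colour (vtx (Visiting.walk vis) j) ≡ colourAt (j + visit-phase vis)
    colourAt-visiting vis j = begin
      colour (vtx walk j)                       ≡⟨ periodic-walk* walk j time ⟩
      colour (vtx walk (j + time * t))          ≡⟨ cong (colour ∘ vtx walk) shift ⟩
      colour (vtx walk (j + time * t₁ + time))  ≡⟨ colourAt-from-centre (drop time walk) visits (j + time * t₁) ⟩
      colourAt (j + time * t₁)                  ∎
      where
        open Visiting vis
        open ≡-Reasoning
        shift : j + time * t ≡ j + time * t₁ + time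
        shift = begin
          j + time * t                  ≡⟨ cong (j +_) (trans (*-suc time t₁) (+-comm time _)) ⟩
          j + (time * t₁ + time)        ≡⟨ +-assoc j _ time ⟨
          j + time * t₁ + time          ∎

    colour-start : ∀ {p u} (vis : Visiting p u) → colour p ≡ colourAt (visit-phase vis)
    colour-start vis = trans (cong colour (sym (Visiting.vtx₀ vis))) (colourAt-visiting vis 0)

    colour-second : ∀ {p u} (vis : Visiting p u) → colour u ≡ colourAt (suc (visit-phase vis))
    colour-second vis = trans (cong colour (sym (Visiting.vtx₁ vis))) (colourAt-visiting vis 1)

    arm-fold : ∀ {r} → r < t → arm r ≡ arm (fold r)
    arm-fold {r} r<t with r ≤? τ
    ... | yes _ = refl
    ... | no  _ = arm-reflect r (<⇒≤ r<t)

    colourAt≡arm∣∣ₘ : ∀ p → colourAt p ≡ arm ∣ p ∣ₘ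
    colourAt≡arm∣∣ₘ p = arm-fold (m%n<n p t)

    phase : V → ℕ
    phase v = visit-phase (visiting (out-edge v))

    index : V → Fin (suc τ)
    index v = fromℕ< (s≤s (∣∣ₘ≤τ (phase v)))

    arm-index : ∀ v → arm (toℕ (index v)) ≡ colour v
    arm-index v = begin
      arm (toℕ (index v))        ≡⟨ cong arm (toℕ-fromℕ< (s≤s (∣∣ₘ≤τ (phase v)))) ⟩
      arm ∣ phase v ∣ₘ           ≡⟨ colourAt≡arm∣∣ₘ (phase v) ⟨
      colourAt (phase v)         ≡⟨ colour-start (visiting (out-edge v)) ⟨
      colour v                   ∎
      where open ≡-Reasoning

  module SurjectiveColouring {m} (colour : V → Fin m) (surjective : Surjective _≡_ _≡_ colour)
                             (periodic : Periodic colour) where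
    open Colouring colour periodic public

    representative : Fin m → Fin (suc τ)
    representative i = index (proj₁ (surjective i))

    arm-representative : ∀ i → arm (toℕ (representative i)) ≡ i
    arm-representative i = trans (arm-index (proj₁ (surjective i))) (proj₂ (surjective i) refl)

    representative-injective : Injective _≡_ _≡_ representative
    representative-injective {i} {j} e = begin
      i                                   ≡⟨ arm-representative i ⟨
      arm (toℕ (representative i))        ≡⟨ cong (arm ∘ toℕ) e ⟩
      arm (toℕ (representative j))        ≡⟨ arm-representative j ⟩
      j                                   ∎
      where open ≡-Reasoning

    colours≤1+τ : m ≤ suc τ
    colours≤1+τ = injective⇒≤ representative-injective

  module ToPartition (colour : V → Fin (suc τ)) (surjective : Surjective _≡_ _≡_ colour)
                     (periodic : Periodic colour) where
    open SurjectiveColouring colour surjective periodic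

    representative-arm : ∀ i → representative (arm (toℕ i)) ≡ i
    representative-arm i with injective⇒surjective representative representative-injective i
    ... | x , refl = cong representative (arm-representative x)

    toℕ-representative-arm : ∀ {r} → r ≤ τ → toℕ (representative (arm r)) ≡ r
    toℕ-representative-arm {r} r≤τ = begin
      toℕ (representative (arm r))                        ≡⟨ cong (toℕ ∘ representative ∘ arm) (toℕ-fromℕ< (s≤s r≤τ)) ⟨
      toℕ (representative (arm (toℕ (fromℕ< (s≤s r≤τ))))) ≡⟨ cong toℕ (representative-arm (fromℕ< (s≤s r≤τ))) ⟩
      toℕ (fromℕ< (s≤s r≤τ))                              ≡⟨ toℕ-fromℕ< (s≤s r≤τ) ⟩
      r                                                   ∎
      where open ≡-Reasoning

    arm-injective : ∀ {r s} → r ≤ τ → s ≤ τ → arm r ≡ arm s → r ≡ s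
    arm-injective r≤τ s≤τ e =
      trans (sym (toℕ-representative-arm r≤τ)) (trans (cong (toℕ ∘ representative) e) (toℕ-representative-arm s≤τ))

    colourAt-injective : ∀ {p q} → colourAt p ≡ colourAt q → colourAt (suc p) ≡ colourAt (suc q) → p ≡ₘ q
    colourAt-injective {p} {q} e e′ = ∣∣ₘ-pair-injective 3≤t (∣∣ₘ-≡ {p} {q} e) (∣∣ₘ-≡ {suc p} {suc q} e′)
      where
        ∣∣ₘ-≡ : ∀ {p q} → colourAt p ≡ colourAt q → ∣ p ∣ₘ ≡ ∣ q ∣ₘ
        ∣∣ₘ-≡ {p} {q} e = arm-injective (∣∣ₘ≤τ p) (∣∣ₘ≤τ q)
          (trans (sym (colourAt≡arm∣∣ₘ p)) (trans e (colourAt≡arm∣∣ₘ q)))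

    edge-phase : ∀ {v w} → v ~ w → ℕ
    edge-phase e = visit-phase (visiting e)

    edge-phase-unique : ∀ {v w} (e : v ~ w) q → colour v ≡ colourAt q → colour w ≡ colourAt (suc q) → edge-phase e ≡ₘ q
    edge-phase-unique e q colour-v colour-w = colourAt-injective {edge-phase e} {q}
      (trans (sym (colour-start (visiting e))) colour-v) (trans (sym (colour-second (visiting e))) colour-w)

    part : (v w : V) → v ~ w → Fin t
    part v w e = fromℕ< (m%n<n (edge-phase e) t)

    part≡ₘphase : ∀ {v w} (e : v ~ w) → toℕ (part v w e) ≡ₘ edge-phase e
    part≡ₘphase e = ≡ₘ-trans (≡⇒≡ₘ (toℕ-fromℕ< (m%n<n (edge-phase e) t))) (m%t≡ₘm (edge-phase e))

    part-step : ∀ v w z (e : v ~ w) (e′ : w ~ z) → z ≢ v → part w z e′ ≡ sucMod (part v w e)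
    part-step v w z e e′ z≢v = toℕ-injective (≡ₘ⇒≡ (toℕ<n (part w z e′)) (toℕ<n (sucMod (part v w e))) (begin
      toℕ (part w z e′)               ≈⟨ part≡ₘphase e′ ⟩
      edge-phase e′                   ≈⟨ edge-phase-unique e′ (suc s) c₁ c₂ ⟩
      suc s                           ≈⟨ +-congˡₘ 1 (edge-phase-unique e s c₀ c₁) ⟨
      suc (edge-phase e)              ≈⟨ +-congˡₘ 1 (part≡ₘphase e) ⟨
      suc (toℕ (part v w e))          ≈⟨ m%t≡ₘm _ ⟨
      suc (toℕ (part v w e)) % t      ≡⟨ toℕ-sucMod (part v w e) ⟨
      toℕ (sucMod (part v w e))       ∎))
      where
        open ≡ₘ-Reasoning
        vis : Visiting v w
        vis = visiting-cons e (z≢v ∘ sym) (visiting e′)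
        s : ℕ
        s = visit-phase vis
        c₀ : colour v ≡ colourAt s
        c₀ = colour-start vis
        c₁ : colour w ≡ colourAt (suc s)
        c₁ = colour-second vis
        c₂ : colour z ≡ colourAt (suc (suc s))
        c₂ = trans (cong colour (sym (Visiting.vtx₁ (visiting e′)))) (colourAt-visiting vis 2)

    part-cover : ∀ (j : Fin t) → ∃ λ v → ∃ λ w → Σ (v ~ w) λ e → part v w e ≡ j
    part-cover j = vtx B (toℕ j) , vtx B (suc (toℕ j)) , edge B (toℕ j) ,
      toℕ-injective (≡ₘ⇒≡ (toℕ<n _) (toℕ<n j) (≡ₘ-trans (part≡ₘphase (edge B (toℕ j))) phase≡j))
      where
        phase≡j : edge-phase (edge B (toℕ j)) ≡ₘ toℕ j
        phase≡j = edge-phase-unique (edge B (toℕ j)) (toℕ j)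
          (colourAt-from-centre B refl (toℕ j)) (colourAt-from-centre B refl (suc (toℕ j)))

    circularlyPartite : CircularlyPartite G t
    circularlyPartite = ≤-trans (s≤s z≤n) 3≤t , part , part-cover , part-step

  module FromPartition (part : (v w : V) → v ~ w → Fin t)
                       (part-step : ∀ v w z (e : v ~ w) (e′ : w ~ z) → z ≢ v → part w z e′ ≡ sucMod (part v w e)) where

    label : ∀ {v w} → v ~ w → ℕ
    label {v} {w} e = toℕ (part v w e)

    label-irrelevant : ∀ {v w} (e e′ : v ~ w) → label e ≡ label e′
    label-irrelevant e e′ = cong label (~-irrelevant e e′)

    label-step : ∀ {v w z} (e : v ~ w) (e′ : w ~ z) → z ≢ v → label e′ ≡ₘ suc (label e)
    label-step {v} {w} {z} e e′ z≢v =
      ≡ₘ-trans (≡⇒≡ₘ (trans (cong toℕ (part-step v w z e e′ z≢v)) (toℕ-sucMod (part v w e)))) (m%t≡ₘm _)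

    label-along : ∀ (f : ℕ → V) N (e : ∀ j → j < N → f j ~ f (suc j)) → (∀ j → suc j < N → f (suc (suc j)) ≢ f j) →
                  (e₀ : f 0 ~ f 1) → ∀ j (j<N : j < N) → label (e j j<N) ≡ₘ label e₀ + j
    label-along f N e nb e₀ zero    j<N = ≡⇒≡ₘ (trans (label-irrelevant _ _) (sym (+-identityʳ _)))
    label-along f N e nb e₀ (suc j) j<N = begin
      label (e (suc j) j<N)          ≈⟨ label-step (e j j<N′) (e (suc j) j<N) (nb j j<N) ⟩
      suc (label (e j j<N′))         ≈⟨ +-congˡₘ 1 (label-along f N e nb e₀ j j<N′) ⟩
      suc (label e₀ + j)             ≡⟨ +-suc (label e₀) j ⟨
      label e₀ + suc j               ∎
      where
        open ≡ₘ-Reasoning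
        j<N′ : j < N
        j<N′ = <-trans (n<1+n j) j<N

    roundTrip : ∀ {v w} → v ~ w → ℕ
    roundTrip e = label e + label (~-sym e)

    roundTrip-sym : ∀ {v w} (e : v ~ w) → roundTrip (~-sym e) ≡ roundTrip e
    roundTrip-sym e = trans (cong (label (~-sym e) +_) (label-irrelevant _ e)) (+-comm (label (~-sym e)) (label e))

    roundTrip-out : ∀ {v u y} (e : v ~ u) (e′ : v ~ y) → roundTrip e ≡ₘ roundTrip e′
    roundTrip-out {v} {u} {y} e e′ with u Fin.≟ y
    ... | yes refl = ≡⇒≡ₘ (cong roundTrip (~-irrelevant e e′))
    ... | no  u≢y  = begin
      label e + label (~-sym e)                 ≈⟨ +-congʳₘ (label (~-sym e)) (label-step (~-sym e′) e u≢y) ⟩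
      suc (label (~-sym e′)) + label (~-sym e)  ≡⟨ +-suc (label (~-sym e′)) _ ⟨
      label (~-sym e′) + suc (label (~-sym e))  ≈⟨ +-congˡₘ (label (~-sym e′)) (label-step (~-sym e) e′ (u≢y ∘ sym)) ⟨
      label (~-sym e′) + label e′               ≡⟨ +-comm (label (~-sym e′)) (label e′) ⟩
      label e′ + label (~-sym e′)               ∎
      where open ≡ₘ-Reasoning

    roundTrip-const : ∀ {v u} (e : v ~ u) → roundTrip e ≡ₘ roundTrip centre~a
    roundTrip-const {v} e = along (connected v w₀) e
      where
        along : ∀ {v u} → Reach G v w₀ → (e : v ~ u) → roundTrip e ≡ₘ roundTrip centre~a
        along here             e = roundTrip-out e centre~a
        along (step v~y reach) e = ≡ₘ-trans (roundTrip-out e v~y)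
                                     (≡ₘ-trans (≡⇒≡ₘ (sym (roundTrip-sym v~y))) (along reach (~-sym v~y)))

    o : ℕ
    o = label centre~a

    label-centre~b : label centre~b ≡ₘ o
    label-centre~b = ≡ₘ-trans (label-step (~-sym centre~c′) centre~b b≢c′)
                              (≡ₘ-sym (label-step (~-sym centre~c′) centre~a a≢c′))

    suc-roundTrip : suc (roundTrip centre~a) ≡ₘ o + o
    suc-roundTrip = begin
      suc (o + label (~-sym centre~a))     ≡⟨ +-suc o _ ⟨
      o + suc (label (~-sym centre~a))     ≈⟨ +-congˡₘ o (label-step (~-sym centre~a) centre~b (a≢b ∘ sym)) ⟨
      o + label centre~b                   ≈⟨ +-congˡₘ o label-centre~b ⟩
      o + o                                ∎
      where open ≡ₘ-Reasoning

    out-labels : ∀ {v u u′} (e : v ~ u) (e′ : v ~ u′) → u ≢ u′ → label e + label e′ ≡ₘ o + o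
    out-labels e e′ u≢u′ = begin
      label e + label e′                   ≈⟨ +-congˡₘ (label e) (label-step (~-sym e) e′ (u≢u′ ∘ sym)) ⟩
      label e + suc (label (~-sym e))      ≡⟨ +-suc (label e) _ ⟩
      suc (roundTrip e)                    ≈⟨ +-congˡₘ 1 (roundTrip-const e) ⟩
      suc (roundTrip centre~a)             ≈⟨ suc-roundTrip ⟩
      o + o                                ∎
      where open ≡ₘ-Reasoning

    -- Shifting by −o makes the two out-labels of a vertex negatives of each other modulo t.
    shift : ℕ
    shift = t ∸ o

    o+shift≡t : o + shift ≡ t
    o+shift≡t = m+[n∸m]≡n (<⇒≤ (toℕ<n (part w₀ a centre~a)))

    shift-neg : ∀ p q → p + q ≡ₘ o + o → (p + shift) + (q + shift) ≡ₘ 0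
    shift-neg p q p+q≡2o = begin
      (p + shift) + (q + shift)      ≡⟨ +-interchange p shift q shift ⟩
      (p + q) + (shift + shift)      ≈⟨ +-congʳₘ (shift + shift) p+q≡2o ⟩
      (o + o) + (shift + shift)      ≡⟨ +-interchange o o shift shift ⟩
      (o + shift) + (o + shift)      ≡⟨ cong₂ _+_ o+shift≡t o+shift≡t ⟩
      t + t                          ≈⟨ m+t≡ₘm t ⟩
      t                              ≈⟨ m+t≡ₘm 0 ⟩
      0                              ∎
      where
        open ≡ₘ-Reasoning
        +-interchange : ∀ w x y z → (w + x) + (y + z) ≡ (w + y) + (x + z)
        +-interchange = solve-∀

    κ : V → ℕ
    κ v = ∣ label (out-edge v) + shift ∣ₘ

    κ-out : ∀ {v u} (e : v ~ u) → ∣ label e + shift ∣ₘ ≡ κ v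
    κ-out {v} {u} e with u Fin.≟ proj₁ (minDeg v)
    ... | yes refl = cong (λ e → ∣ label e + shift ∣ₘ) (~-irrelevant e (out-edge v))
    ... | no  u≢   = ∣∣ₘ-neg (label e + shift) (label (out-edge v) + shift)
                       (shift-neg (label e) (label (out-edge v)) (out-labels e (out-edge v) u≢))

    colouring : V → Fin (suc τ)
    colouring v = fromℕ< (s≤s (∣∣ₘ≤τ (label (out-edge v) + shift)))

    colouring-≡ : ∀ {u v} → κ u ≡ κ v → colouring u ≡ colouring v
    colouring-≡ {u} {v} e = fromℕ<-cong (κ u) (κ v) e _ _

    label-arm : ∀ j → label (edge B j) + shift ≡ₘ j
    label-arm j = begin
      label (edge B j) + shift        ≈⟨ +-congʳₘ shift (label-along (vtx B) (suc j) (λ i _ → edge B i)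
                                           (λ i _ → nonBacktracking B i ∘ sym) centre~b j ≤-refl) ⟩
      label centre~b + j + shift      ≈⟨ +-congʳₘ shift (+-congʳₘ j label-centre~b) ⟩
      o + j + shift                   ≡⟨ +-comm-middle o j shift ⟩
      o + shift + j                   ≡⟨ cong (_+ j) o+shift≡t ⟩
      t + j                           ≡⟨ +-comm t j ⟩
      j + t                           ≈⟨ m+t≡ₘm j ⟩
      j                               ∎
      where
        open ≡ₘ-Reasoning
        +-comm-middle : ∀ x y z → x + y + z ≡ x + z + y
        +-comm-middle = solve-∀

    colouring-surjective : Surjective _≡_ _≡_ colouring
    colouring-surjective i = vtx B (toℕ i) , λ { refl → toℕ-injective (begin
      toℕ (colouring (vtx B (toℕ i)))          ≡⟨ toℕ-fromℕ< _ ⟩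
      κ (vtx B (toℕ i))                        ≡⟨ κ-out (edge B (toℕ i)) ⟨
      ∣ label (edge B (toℕ i)) + shift ∣ₘ       ≡⟨ ∣∣ₘ-cong (label-arm (toℕ i)) ⟩
      ∣ toℕ i ∣ₘ                               ≡⟨ ∣∣ₘ-small (s≤s⁻¹ (toℕ<n i)) ⟩
      toℕ i                                    ∎) }
      where open ≡-Reasoning

    module OnPath (P : Path G t) where
      index : ℕ → Fin (suc t)
      index j = fromℕ< (m%n<n j (suc t))

      toℕ-index : ∀ {j} → j ≤ t → toℕ (index j) ≡ j
      toℕ-index {j} j≤t = trans (toℕ-fromℕ< (m%n<n j (suc t))) (m<n⇒m%n≡m (s≤s j≤t))

      at : ℕ → V
      at j = Path.vtx P (index j)

      at-edge : ∀ j → j < t → at j ~ at (suc j)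
      at-edge j j<t = subst₂ _~_ (cong (Path.vtx P) (toℕ-injective from≡)) (cong (Path.vtx P) (toℕ-injective to≡))
                               (Path.edge P (fromℕ< j<t))
        where
          from≡ : toℕ (Fin.inject₁ (fromℕ< j<t)) ≡ toℕ (index j)
          from≡ = trans (toℕ-inject₁ _) (trans (toℕ-fromℕ< j<t) (sym (toℕ-index (<⇒≤ j<t))))
          to≡ : toℕ (Fin.suc (fromℕ< j<t)) ≡ toℕ (index (suc j))
          to≡ = trans (cong suc (toℕ-fromℕ< j<t)) (sym (toℕ-index j<t))

      at-nb : ∀ j → suc j < t → at (suc (suc j)) ≢ at j
      at-nb j 1+j<t e = contradiction (trans (sym (toℕ-index 1+j<t)) (trans (cong toℕ (Path.inj P e)) (toℕ-index j≤t)))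
                                      (>⇒≢ (<-trans (n<1+n j) (n<1+n (suc j))))
        where
          j≤t : j ≤ t
          j≤t = ≤-trans (n≤1+n j) (<⇒≤ 1+j<t)

      first : at 0 ~ at 1
      first = at-edge 0 (s≤s z≤n)

      last : at t₁ ~ at t
      last = at-edge t₁ ≤-refl

      ends-labels : label first + label (~-sym last) ≡ₘ o + o
      ends-labels = +-cancelʳₘ _ _ t (begin
        label first + label (~-sym last) + t       ≡⟨ rearrange (label first) (label (~-sym last)) t₁ ⟩
        suc (label first + t₁) + label (~-sym last) ≈⟨ +-congʳₘ (label (~-sym last)) (+-congˡₘ 1 last-label) ⟨
        suc (roundTrip last)                       ≈⟨ +-congˡₘ 1 (roundTrip-const last) ⟩
        suc (roundTrip centre~a)                   ≈⟨ suc-roundTrip ⟩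
        o + o                                      ≈⟨ m+t≡ₘm (o + o) ⟨
        o + o + t                                  ∎)
        where
          open ≡ₘ-Reasoning
          last-label : label last ≡ₘ label first + t₁
          last-label = label-along at t at-edge at-nb first t₁ ≤-refl
          rearrange : ∀ x y z → x + y + suc z ≡ suc (x + z) + y
          rearrange = solve-∀

      κ-ends : κ (at 0) ≡ κ (at t)
      κ-ends = begin
        κ (at 0)                                   ≡⟨ κ-out first ⟨
        ∣ label first + shift ∣ₘ                   ≡⟨ ∣∣ₘ-neg (label first + shift) (label (~-sym last) + shift)
                                                        (shift-neg (label first) (label (~-sym last)) ends-labels) ⟩
        ∣ label (~-sym last) + shift ∣ₘ            ≡⟨ κ-out (~-sym last) ⟩
        κ (at t)                                   ∎
        where open ≡-Reasoning

      at-t : at t ≡ Path.vtx P (Fin.fromℕ t)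
      at-t = cong (Path.vtx P) (toℕ-injective (trans (toℕ-index ≤-refl) (sym (toℕ-fromℕ t))))

    colouring-periodic : Periodic colouring
    colouring-periodic P = colouring-≡ (trans κ-ends (cong κ at-t))
      where open OnPath P

  colouring⇒circularlyPartite : χ≡ G t (suc τ) → CircularlyPartite G t
  colouring⇒circularlyPartite ((colour , surjective , periodic) , _) =
    ToPartition.circularlyPartite colour surjective periodic

  circularlyPartite⇒colouring : CircularlyPartite G t → χ≡ G t (suc τ)
  circularlyPartite⇒colouring (_ , part , _ , part-step) =
    (colouring , colouring-surjective , colouring-periodic) ,
    λ m (colour , surjective , periodic) → SurjectiveColouring.colours≤1+τ colour surjective periodic
    where open FromPartition part part-step

¬cycleGraph⇒claw : (G : Graph) → Connected G → MinDeg≥2 G → ¬ IsCycleGraph G → Fin (Graph.n G) → Basics.Claw G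
¬cycleGraph⇒claw G connected minDeg ¬cycle v with Basics.claw? G
... | yes claw     = claw
... | no  clawFree = contradiction (ClawFree.clawFree⇒cycleGraph G connected minDeg clawFree v) ¬cycle

theorem5p2 : (G : Graph) → Connected G → MinDeg≥2 G → ¬ IsCycleGraph G →
    (t : ℕ) → 3 ≤ t → t≤Girth G t →
    (χ≡ G t (suc (t / 2)) ⇔ CircularlyPartite G t)
theorem5p2 G connected minDeg ¬cycle (suc t₁) 3≤t girth = mk⇔
  (λ χ → WithClaw.colouring⇒circularlyPartite G connected minDeg t₁ 3≤t girth (claw (vertex-of-colouring χ)) χ)
  (λ cp → WithClaw.circularlyPartite⇒colouring G connected minDeg t₁ 3≤t girth (claw (vertex-of-partition cp)) cp)
  where
    claw : Fin (Graph.n G) → Basics.Claw G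
    claw = ¬cycleGraph⇒claw G connected minDeg ¬cycle
    -- A claw needs a vertex; the empty graph is not a cycle graph, but either side yields a vertex.
    vertex-of-colouring : χ≡ G (suc t₁) (suc (suc t₁ / 2)) → Fin (Graph.n G)
    vertex-of-colouring ((_ , surjective , _) , _) = proj₁ (surjective Fin.zero)
    vertex-of-partition : CircularlyPartite G (suc t₁) → Fin (Graph.n G)
    vertex-of-partition (_ , _ , cover , _) = proj₁ (cover Fin.zero)
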